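{- Let $N$ be a combinational circuit with set of input variables $X=\{x_1,\dots,x_m\}$, set of internal variables $Y$ and set of output variables $Z$, and let $F(X,Y,Z)$ be a CNF formula defining $N$. Let $g$ be an AND gate of $N$ with inputs $v_1,v_2$ and output $v_3$, and let $C=\overline{v}_1\vee\overline{v}_2\vee v_3$ be the corresponding clause of $F$, where $\{v_1,v_2,v_3\}\cap X=\emptyset$. Fix literals $l(x_1),\dots,l(x_m)$, let $C'=C\vee\overline{l(x_1)}\vee\dots\vee\overline{l(x_m)}$ and $F'=(F\setminus\{C\})\cup\{C\vee l(x_1),\dots,C\vee l(x_m)\}$. Suppose $C'$ is non-redundant in $\exists Y\,[C'\wedge F']$, i.e. $\exists Y[C'\wedge F']\not\equiv\exists Y[F']$. Then the formula $Q(X,Z)$ produced by the procedure QuickPQE below is a single-test property of $N$. QuickPQE: (1) Let $\mathbf{x}'$ be the assignment to $X$ satisfying $l(x_1),\dots,l(x_m)$. Simulate $N$ on $\mathbf{x}'$, obtaining output $\mathbf{z}'$; if $v_1$ or $v_2$ is assigned $0$, output the empty set of clauses. (2) Otherwise simulate $N$ on $\mathbf{x}'$ with gate $g$ forced to output $v_3=0$, obtaining output $\mathbf{z}^*$; if $\mathbf{z}^*=\mathbf{z}'$, output the empty set of clauses. (3) Otherwise output $Q$ consisting of the clauses $B_{\mathbf{x}'}\vee l(z_j)$ for each output variable $z_j$ assigned differently in $\mathbf{z}'$ and $\mathbf{z}^*$, where $B_{\mathbf{x}'}=\overline{l(x_1)}\vee\dots\vee\overline{l(x_m)}$ and $l(z_j)$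 is the literal of $z_j$ satisfied by $\mathbf{z}'$.
   Context: All formulas are propositional CNF formulas (conjunctions/sets of clauses, clauses being disjunctions of literals). A CNF formula $F(X,Y,Z)$ defines the circuit $N$ if every consistent assignment to the variables of $N$ corresponds to a satisfying assignment of $F$ and vice versa (it is the conjunction over gates of the clauses falsified by value combinations inconsistent with each gate). Single-test property: let $\mathbf{x}'$ be an assignment to $X$ (a test) and $\mathbf{z}'$ the output assignment produced by $N$ on $\mathbf{x}'$. A formula $Q(X,Z)$ is a single-test property of $N$ (for test $\mathbf{x}'$) if (i) $Q(\mathbf{x},\mathbf{z})=1$ for every assignment $\mathbf{x}\neq\mathbf{x}'$ to $X$ and every assignment $\mathbf{z}$ to $Z$; (ii) $Q(\mathbf{x}',\mathbf{z}')=1$; (iii) $Q(\mathbf{x}',\mathbf{z})=0$ for at least one $\mathbf{z}\neq\mathbf{z}'$. -}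

module Defs where

open import Data.Nat using (ℕ; zero; suc; _≤_; _<_; _≡ᵇ_)
open import Data.Bool using (Bool; true; false; not; _∧_; _∨_; if_then_else_)
open import Data.Bool.Properties using () renaming (_≟_ to _≟ᵇ_)
open import Data.Fin using (Fin; toℕ; fromℕ; inject₁) renaming (_≟_ to _≟ᶠ_)
open import Data.Vec using (Vec; []; _∷_; _∷ʳ_; lookup; tabulate)
import Data.Vec as Vec
open import Data.Vec.Properties using () renaming (≡-dec to vec-≡-dec)
open import Data.List using (List; []; _∷_; _++_; map; concatMap; filterᵇ; allFin)
open import Data.Bool.ListAction using (any; all)
open import Data.Maybe using (Maybe; just; nothing)
open import Data.Product using (Σ; ∃; _×_; _,_)
open import Data.Sum using (_⊎_; inj₁; inj₂; [_,_])
open import Relation.Nullary using (¬_; does)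
open import Relation.Binary.PropositionalEquality using (_≡_; _≢_)
open import Function.Definitions using (Injective)

-- A literal: a variable together with its polarity
-- (true = positive literal v, false = negative literal ¬v).
Lit : Set → Set
Lit V = V × Bool

Clause : Set → Set
Clause V = List (Lit V)

CNF : Set → Set
CNF V = List (Clause V)

litVal : ∀ {V : Set} → (V → Bool) → Lit V → Bool
litVal a (v , true)  = a v
litVal a (v , false) = not (a v)

clauseVal : ∀ {V : Set} → (V → Bool) → Clause V → Bool
clauseVal a C = any (litVal a) C

cnfVal : ∀ {V : Set} → (V → Bool) → CNF V → Bool
cnfVal a F = all (clauseVal a) F

negLit : ∀ {V : Set} → Lit V → Lit V
negLit (v , b) = v , not b

-- Variables of a circuit with m inputs are Fin n; the variables with
-- toℕ < m are the inputs x₁..xₘ, and every further variable is the output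
-- of exactly one gate, whose inputs are earlier variables (acyclicity).

record Gate (n : ℕ) : Set where
  constructor mkGate
  field
    arity : ℕ
    fanin : Vec (Fin n) arity
    fn    : Vec Bool arity → Bool

-- Gates m n : the gate list of a circuit with m inputs and n variables in
-- total; (G ▷ g) adds a gate g over the existing n variables whose output
-- is the new variable fromℕ n.
data Gates (m : ℕ) : ℕ → Set where
  []  : Gates m m
  _▷_ : ∀ {n} → Gates m n → Gate n → Gates m (suc n)

liftLit : ∀ {n} → Lit (Fin n) → Lit (Fin (suc n))
liftLit (v , b) = inject₁ v , b

liftClause : ∀ {n} → Clause (Fin n) → Clause (Fin (suc n))
liftClause = map liftLit

allVecs : (a : ℕ) → List (Vec Bool a)
allVecs zero    = [] ∷ []
allVecs (suc a) = map (true ∷_) (allVecs a) ++ map (false ∷_) (allVecs a)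

comboClause : ∀ {n a} → Vec (Fin n) a → Fin n → Vec Bool a → Bool → Clause (Fin n)
comboClause fi w c o = Vec.toList (Vec.zipWith (λ v b → (v , not b)) fi c) ++ ((w , not o) ∷ [])

-- Clauses of one gate with output variable w: the clauses falsified by the
-- value combinations inconsistent with the gate.
gateClauses : ∀ {n} → Gate n → Fin n → CNF (Fin n)
gateClauses (mkGate a fi f) w =
  concatMap (λ c → map (comboClause fi w c)
                       (filterᵇ (λ o → not (does (f c ≟ᵇ o))) (true ∷ false ∷ [])))
            (allVecs a)

encode : ∀ {m n} → Gates m n → CNF (Fin n)
encode []              = []
encode (_▷_ {n} G g)   =
  map liftClause (encode G) ++ gateClauses (mkGate (Gate.arity g) (Vec.map inject₁ (Gate.fanin g)) (Gate.fn g)) (fromℕ n)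

inputVar : ∀ {m n} → Gates m n → Fin m → Fin n
inputVar []      i = i
inputVar (G ▷ g) i = inject₁ (inputVar G i)

-- Simulation of the circuit on an input assignment, with an optional
-- override (indexed by the ℕ-index of a gate's output variable) forcing
-- the output of a gate to a constant.
simulate : ∀ {m n} → Gates m n → Vec Bool m → (ℕ → Maybe Bool) → Vec Bool n
simulate []            x ov = x
simulate (_▷_ {n} G g) x ov with simulate G x ov
... | s with ov n
...   | just b  = s ∷ʳ b
...   | nothing = s ∷ʳ Gate.fn g (Vec.map (lookup s) (Gate.fanin g))

noOverride : ℕ → Maybe Bool
noOverride _ = nothing

forceZero : ∀ {n} → Fin n → ℕ → Maybe Bool
forceZero w i = if i ≡ᵇ toℕ w then just false else nothing

data AndGate {m : ℕ} : ∀ {n} → Gates m n → Fin n → Fin n → Fin n → Set where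
  here  : ∀ {n} {G : Gates m n} {v₁ v₂ : Fin n} {f : Vec Bool 2 → Bool} →
          (∀ b c → f (b ∷ c ∷ []) ≡ b ∧ c) →
          AndGate (G ▷ mkGate 2 (v₁ ∷ v₂ ∷ []) f) (inject₁ v₁) (inject₁ v₂) (fromℕ n)
  there : ∀ {n} {G : Gates m n} {g : Gate n} {v₁ v₂ v₃ : Fin n} →
          AndGate G v₁ v₂ v₃ →
          AndGate (G ▷ g) (inject₁ v₁) (inject₁ v₂) (inject₁ v₃)

-- A combinational circuit N with m inputs X and p outputs Z.  The outputs
-- are distinct non-input variables; Y = the remaining (internal) variables.
record Circuit (m p : ℕ) : Set where
  field
    nvars    : ℕ
    gates    : Gates m nvars
    out      : Fin p → Fin nvars
    out-gate : ∀ j → m ≤ toℕ (out j)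
    out-inj  : Injective _≡_ _≡_ out

open Circuit public

module _ {m p : ℕ} (N : Circuit m p) where

  IsInput : Fin (nvars N) → Set
  IsInput v = toℕ v < m

  IsOutput : Fin (nvars N) → Set
  IsOutput v = ∃ λ j → out N j ≡ v

  F : CNF (Fin (nvars N))
  F = encode (gates N)

  outputs : Vec Bool m → (ℕ → Maybe Bool) → Vec Bool p
  outputs x ov = tabulate (λ j → lookup (simulate (gates N) x ov) (out N j))

  ExistsY : CNF (Fin (nvars N)) → (Fin (nvars N) → Bool) → Set
  ExistsY G a = ∃ λ b → (∀ v → IsInput v ⊎ IsOutput v → b v ≡ a v) × cnfVal b G ≡ true

  EquivExistsY : CNF (Fin (nvars N)) → CNF (Fin (nvars N)) → Set
  EquivExistsY G₁ G₂ = ∀ a → (ExistsY G₁ a → ExistsY G₂ a) × (ExistsY G₂ a → ExistsY G₁ a)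

  -- l(x_i) is given by the polarity vector pol: l(x_i) = x_i if
  -- lookup pol i = true, and ¬x_i otherwise.
  module _ (pol : Vec Bool m) (v₁ v₂ v₃ : Fin (nvars N)) where

    lx : Fin m → Lit (Fin (nvars N))
    lx i = inputVar (gates N) i , lookup pol i

    C : Clause (Fin (nvars N))
    C = (v₁ , false) ∷ (v₂ , false) ∷ (v₃ , true) ∷ []

    C′ : Clause (Fin (nvars N))
    C′ = C ++ map (λ i → negLit (lx i)) (allFin m)

    litEqᵇ : Lit (Fin (nvars N)) → Lit (Fin (nvars N)) → Bool
    litEqᵇ (v , b) (w , c) = does (v ≟ᶠ w) ∧ does (b ≟ᵇ c)

    clauseEqᵇ : Clause (Fin (nvars N)) → Clause (Fin (nvars N)) → Bool
    clauseEqᵇ []      []      = true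
    clauseEqᵇ (l ∷ D) (k ∷ E) = litEqᵇ l k ∧ clauseEqᵇ D E
    clauseEqᵇ _       _       = false

    F′ : CNF (Fin (nvars N))
    F′ = filterᵇ (λ D → not (clauseEqᵇ D C)) F ++ map (λ i → C ++ (lx i ∷ [])) (allFin m)

    NonRedundant : Set
    NonRedundant = ¬ EquivExistsY (C′ ∷ F′) F′

    -- The procedure QuickPQE; its output Q(X,Z) is a CNF over the
    -- variables X ⊎ Z (inj₁ i = x_i, inj₂ j = z_j).
    QuickPQE : CNF (Fin m ⊎ Fin p)
    QuickPQE with lookup (simulate (gates N) pol noOverride) v₁ ∧ lookup (simulate (gates N) pol noOverride) v₂
    ... | false = []
    ... | true with does (vec-≡-dec _≟ᵇ_ (outputs pol (forceZero v₃)) (outputs pol noOverride))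
    ...   | true  = []
    ...   | false =
            map (λ j → B ++ ((inj₂ j , lookup z′ j) ∷ []))
                (filterᵇ (λ j → not (does (lookup z′ j ≟ᵇ lookup z* j))) (allFin p))
      where
        z′ z* : Vec Bool p
        z′ = outputs pol noOverride
        z* = outputs pol (forceZero v₃)
        B : Clause (Fin m ⊎ Fin p)
        B = map (λ i → inj₁ i , not (lookup pol i)) (allFin m)

  QVal : CNF (Fin m ⊎ Fin p) → Vec Bool m → Vec Bool p → Bool
  QVal Q x z = cnfVal [ lookup x , lookup z ] Q

  SingleTestProperty : Vec Bool m → CNF (Fin m ⊎ Fin p) → Set
  SingleTestProperty x′ Q =
      (∀ x z → x ≢ x′ → QVal Q x z ≡ true)
    × QVal Q x′ (outputs x′ noOverride) ≡ true
    × ∃ λ z → z ≢ outputs x′ noOverride × QVal Q x′ z ≡ false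

-- Let s be the run of N on the test x′ and s* its run with g forced to output 0.  An assignment b
-- that satisfies F′ but falsifies C′ sets v₁ = v₂ = 1, v₃ = 0 and X = x′, and satisfies every clause
-- of F except C; such a b is a run of N with g forced to 0, so b = s*.  If s gave v₁ ∧ v₂ = 0 no
-- such b could exist, because forcing g does not change its inputs; if z* = z′, then s satisfies
-- C′ ∧ F′ and agrees with b on X ∪ Z.  Either way C′ would be redundant in ∃Y[C′ ∧ F′].  Hence
-- QuickPQE reaches step (3) with z* ≠ z′, and its clauses B_{x′} ∨ l(z_j) hold off the test, hold
-- at (x′, z′), and one of them fails at (x′, z*).

module Submission where

open import Defs
open import Data.Nat using (ℕ; zero; suc; _≤_; _<_)
open import Data.Nat.Properties using (≡ᵇ⇒≡; ≡⇒≡ᵇ; ≤-reflexive; <⇒≤; ≤-<-trans; <-irrefl; n<1+n; m<n⇒m<1+n)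
open import Data.Bool using (Bool; true; false; not; _∧_; T; T?)
open import Data.Bool.Properties using (T-≡; T-not-≡; T-∧; T-∨; ¬-not; not-¬; not-involutive)
  renaming (_≟_ to _≟ᵇ_)
open import Data.Bool.ListAction using (or)
open import Data.Fin using (Fin; toℕ; fromℕ; inject₁; fromℕ<) renaming (_≟_ to _≟ᶠ_)
open import Data.Fin.Properties
  using (toℕ-inject₁; toℕ-fromℕ; toℕ-fromℕ<; toℕ-injective; toℕ<n; fromℕ≢inject₁; inject₁-injective; ¬∀⟶∃¬)
open import Data.Vec using (Vec; []; _∷_; _∷ʳ_; lookup)
import Data.Vec as Vec
open import Data.Vec.Properties using (lookup∘tabulate)
  renaming (≡-dec to vec-≡-dec; map-cong to vmap-cong; map-∘ to vmap-∘)
open import Data.Vec.Relation.Binary.Pointwise.Extensional using (ext; Pointwise-≡⇒≡)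
open import Data.List using ([]; _∷_; _++_; map; filterᵇ; allFin)
open import Data.List.Properties using (map-∘; map-cong; map-injective)
open import Data.List.Relation.Unary.All as All using (All; []; _∷_)
open import Data.List.Relation.Unary.All.Properties using (all⁺; all⁻; ++⁺; ++⁻ˡ; ++⁻ʳ; map⁺; map⁻; filter⁺)
open import Data.List.Relation.Unary.Any using (here; there)
import Data.List.Relation.Unary.Any.Properties as Any
open import Data.List.Membership.Propositional using (_∈_; _∉_; find; lose)
open import Data.List.Membership.Propositional.Properties
  using (∈-map⁺; ∈-map⁻; ∈-++⁺ˡ; ∈-++⁺ʳ; ∈-concatMap⁺; ∈-concatMap⁻; ∈-allFin; ∈-filter⁺; ∈-filter⁻)
open import Data.Maybe using (Maybe; just; nothing; fromMaybe)
open import Data.Product using (∃; ∃₂; _×_; _,_; proj₁; proj₂)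
open import Data.Sum using (_⊎_; inj₁; inj₂; [_,_])
import Data.Sum as Sum
open import Data.Unit using (⊤; tt)
open import Function using (_∘_; _⇔_; mk⇔; Equivalence)
open import Relation.Nullary using (¬_; Dec; does; yes; no; contradiction)
open import Relation.Nullary.Decidable using (dec-false)
open import Relation.Binary.PropositionalEquality hiding ([_])

open Equivalence using (to; from)

T-does⁻ : ∀ {A : Set} (a? : Dec A) → T (does a?) → A
T-does⁻ (yes a) _ = a

T-not-does⁺ : ∀ {A : Set} (a? : Dec A) → ¬ A → T (not (does a?))
T-not-does⁺ a? ¬a = from T-not-≡ (dec-false a? ¬a)

T-not-does⁻ : ∀ {A : Set} (a? : Dec A) → T (not (does a?)) → ¬ A
T-not-does⁻ (no ¬a) _ = ¬a

¬T⇒≡false : ∀ {x} → ¬ T x → x ≡ false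
¬T⇒≡false ¬x = ¬-not (¬x ∘ from T-≡)

module _ {V : Set} (a : V → Bool) where

  T-litVal : ∀ v c → T (litVal a (v , c)) ⇔ a v ≡ c
  T-litVal v true  = T-≡
  T-litVal v false = T-not-≡

  ¬T-litVal : ∀ {v c} → ¬ T (litVal a (v , c)) → a v ≡ not c
  ¬T-litVal {v} {c} ¬t = ¬-not (¬t ∘ from (T-litVal v c))

  T-litVal-not : ∀ {v c} → a v ≢ c → T (litVal a (v , not c))
  T-litVal-not {v} {c} av≢c = from (T-litVal v (not c)) (¬-not av≢c)

  ¬T-litVal-not : ∀ {v c} → a v ≡ c → ¬ T (litVal a (v , not c))
  ¬T-litVal-not {v} {c} av≡c = not-¬ av≡c ∘ to (T-litVal v (not c))

  T-clauseVal⁺ : ∀ {l D} → l ∈ D → T (litVal a l) → T (clauseVal a D)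
  T-clauseVal⁺ l∈D t = Any.any⁺ (litVal a) (lose l∈D t)

  ¬T-clauseVal⁺ : ∀ {D} → (∀ {l} → l ∈ D → ¬ T (litVal a l)) → ¬ T (clauseVal a D)
  ¬T-clauseVal⁺ {D} ¬lits t with find (Any.any⁻ (litVal a) D t)
  ... | _ , l∈D , tl = ¬lits l∈D tl

  ¬T-clauseVal⁻ : ∀ {l D} → ¬ T (clauseVal a D) → l ∈ D → ¬ T (litVal a l)
  ¬T-clauseVal⁻ ¬t l∈D = ¬t ∘ T-clauseVal⁺ l∈D

  T-clauseVal-++⁻ : ∀ D {E} → T (clauseVal a (D ++ E)) → T (clauseVal a D) ⊎ T (clauseVal a E)
  T-clauseVal-++⁻ D = Sum.map (Any.any⁺ _) (Any.any⁺ _) ∘ Any.++⁻ D ∘ Any.any⁻ _ _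

  T-clauseVal-++ˡ : ∀ D {E} → T (clauseVal a D) → T (clauseVal a (D ++ E))
  T-clauseVal-++ˡ D = Any.any⁺ _ ∘ Any.++⁺ˡ ∘ Any.any⁻ _ D

  T-clauseVal-++ʳ : ∀ D {E} → T (clauseVal a E) → T (clauseVal a (D ++ E))
  T-clauseVal-++ʳ D {E} = Any.any⁺ _ ∘ Any.++⁺ʳ D ∘ Any.any⁻ _ E

Satisfies : ∀ {V : Set} → (V → Bool) → CNF V → Set
Satisfies a F = All (T ∘ clauseVal a) F

Satisfies⇔cnfVal : ∀ {V : Set} (a : V → Bool) F → Satisfies a F ⇔ cnfVal a F ≡ true
Satisfies⇔cnfVal a F = mk⇔ (to T-≡ ∘ all⁻ (clauseVal a)) (all⁺ (clauseVal a) F ∘ from T-≡)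

SatisfiesAllBut : ∀ {V : Set} → (V → Bool) → Clause V → CNF V → Set
SatisfiesAllBut a C F = ∀ {D} → D ∈ F → D ≢ C → T (clauseVal a D)

zipClause : ∀ {n a} → Vec (Fin n) a → Vec Bool a → Clause (Fin n)
zipClause fi c = Vec.toList (Vec.zipWith (λ v b → (v , not b)) fi c)

module _ {n} (b : Fin n → Bool) where

  ¬T-zipClause : ∀ {a} (fi : Vec (Fin n) a) → ¬ T (clauseVal b (zipClause fi (Vec.map b fi)))
  ¬T-zipClause []       ()
  ¬T-zipClause (v ∷ fi) t = [ ¬T-litVal-not b refl , ¬T-zipClause fi ] (to T-∨ t)

  T-zipClause : ∀ {a} (fi : Vec (Fin n) a) c → Vec.map b fi ≢ c → T (clauseVal b (zipClause fi c))
  T-zipClause []       []       ne = contradiction refl ne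
  T-zipClause (v ∷ fi) (c ∷ cs) ne with b v ≟ᵇ c
  ... | yes bv≡c = from T-∨ (inj₂ (T-zipClause fi cs (ne ∘ cong₂ _∷_ bv≡c)))
  ... | no  bv≢c = from T-∨ (inj₁ (T-litVal-not b bv≢c))

  ¬T-comboClause : ∀ {a} (fi : Vec (Fin n) a) w → ¬ T (clauseVal b (comboClause fi w (Vec.map b fi) (b w)))
  ¬T-comboClause fi w t with T-clauseVal-++⁻ b (zipClause fi (Vec.map b fi)) t
  ... | inj₁ tzip = ¬T-zipClause fi tzip
  ... | inj₂ tout = [ ¬T-litVal-not b refl , (λ ()) ] (to T-∨ tout)

  T-comboClause : ∀ {a} (fi : Vec (Fin n) a) w c o →
                  Vec.map b fi ≢ c ⊎ b w ≢ o → T (clauseVal b (comboClause fi w c o))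
  T-comboClause fi w c o (inj₁ ne) = T-clauseVal-++ˡ b (zipClause fi c) (T-zipClause fi c ne)
  T-comboClause fi w c o (inj₂ ne) = T-clauseVal-++ʳ b (zipClause fi c) (from T-∨ (inj₁ (T-litVal-not b ne)))

∈-allVecs : ∀ {a} (c : Vec Bool a) → c ∈ allVecs a
∈-allVecs []          = here refl
∈-allVecs {suc a} (true  ∷ c) = ∈-++⁺ˡ (∈-map⁺ (true ∷_) (∈-allVecs c))
∈-allVecs {suc a} (false ∷ c) = ∈-++⁺ʳ (map (true ∷_) (allVecs a)) (∈-map⁺ (false ∷_) (∈-allVecs c))

∈-bools : ∀ o → o ∈ true ∷ false ∷ []
∈-bools true  = here refl
∈-bools false = there (here refl)

module _ {n a} (fi : Vec (Fin n) a) (f : Vec Bool a → Bool) (w : Fin n) where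

  private
    inconsistent : Vec Bool a → Bool → Bool
    inconsistent c o = not (does (f c ≟ᵇ o))

    clausesFor : Vec Bool a → CNF (Fin n)
    clausesFor c = map (comboClause fi w c) (filterᵇ (inconsistent c) (true ∷ false ∷ []))

  ∈-gateClauses⁺ : ∀ {c o} → f c ≢ o → comboClause fi w c o ∈ gateClauses (mkGate a fi f) w
  ∈-gateClauses⁺ {c} {o} fc≢o =
    ∈-concatMap⁺ clausesFor (lose (∈-allVecs c)
      (∈-map⁺ (comboClause fi w c) (∈-filter⁺ (T? ∘ inconsistent c) (∈-bools o) (T-not-does⁺ (f c ≟ᵇ o) fc≢o))))

  ∈-gateClauses⁻ : ∀ {D} → D ∈ gateClauses (mkGate a fi f) w →
                   ∃₂ λ c o → f c ≢ o × D ≡ comboClause fi w c o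
  ∈-gateClauses⁻ D∈ with find (∈-concatMap⁻ clausesFor {xs = allVecs a} D∈)
  ... | c , _ , D∈c with ∈-map⁻ (comboClause fi w c) D∈c
  ...   | o , o∈ , D≡ = c , o , T-not-does⁻ (f c ≟ᵇ o) (proj₂ (∈-filter⁻ (T? ∘ inconsistent c) o∈)) , D≡

  ∈-gateClauses-output : ∀ {D} → D ∈ gateClauses (mkGate a fi f) w → ∃ λ o → (w , o) ∈ D
  ∈-gateClauses-output D∈ with ∈-gateClauses⁻ D∈
  ... | c , o , _ , refl = not o , ∈-++⁺ʳ (zipClause fi c) (here refl)

  module _ (b : Fin n → Bool) where

    Satisfies-gateClauses⁺ : b w ≡ f (Vec.map b fi) → Satisfies b (gateClauses (mkGate a fi f) w)
    Satisfies-gateClauses⁺ bw = All.tabulate satisfied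
      where
        satisfied : ∀ {D} → D ∈ gateClauses (mkGate a fi f) w → T (clauseVal b D)
        satisfied D∈ with ∈-gateClauses⁻ D∈
        ... | c , o , fc≢o , refl with vec-≡-dec _≟ᵇ_ (Vec.map b fi) c
        ...   | yes refl = T-comboClause b fi w c o (inj₂ (fc≢o ∘ trans (sym bw)))
        ...   | no  ne   = T-comboClause b fi w c o (inj₁ ne)

    Satisfies-gateClauses⁻ : Satisfies b (gateClauses (mkGate a fi f) w) → b w ≡ f (Vec.map b fi)
    Satisfies-gateClauses⁻ sat with f (Vec.map b fi) ≟ᵇ b w
    ... | yes fb≡bw = sym fb≡bw
    ... | no  fb≢bw = contradiction (All.lookup sat (∈-gateClauses⁺ fb≢bw)) (¬T-comboClause b fi w)

-- Runs of a circuit and the encoding F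

evalGate : ∀ {n} → Gate n → (Fin n → Bool) → Bool
evalGate g b = Gate.fn g (Vec.map b (Gate.fanin g))

liftGate : ∀ {n} → Gate n → Gate (suc n)
liftGate g = mkGate (Gate.arity g) (Vec.map inject₁ (Gate.fanin g)) (Gate.fn g)

evalGate-liftGate : ∀ {n} (g : Gate n) (b : Fin (suc n) → Bool) →
                    Gate.fn g (Vec.map b (Gate.fanin (liftGate g))) ≡ evalGate g (b ∘ inject₁)
evalGate-liftGate g b = cong (Gate.fn g) (sym (vmap-∘ b inject₁ (Gate.fanin g)))

lookup-∷ʳ-inject₁ : ∀ {A : Set} {n} (xs : Vec A n) x i → lookup (xs ∷ʳ x) (inject₁ i) ≡ lookup xs i
lookup-∷ʳ-inject₁ (y ∷ xs) x Fin.zero    = refl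
lookup-∷ʳ-inject₁ (y ∷ xs) x (Fin.suc i) = lookup-∷ʳ-inject₁ xs x i

lookup-∷ʳ-fromℕ : ∀ {A : Set} {n} (xs : Vec A n) x → lookup (xs ∷ʳ x) (fromℕ n) ≡ x
lookup-∷ʳ-fromℕ []       x = refl
lookup-∷ʳ-fromℕ (y ∷ xs) x = lookup-∷ʳ-fromℕ xs x

inject₁-or-fromℕ : ∀ {n} (v : Fin (suc n)) → (∃ λ i → v ≡ inject₁ i) ⊎ v ≡ fromℕ n
inject₁-or-fromℕ {zero}  Fin.zero    = inj₂ refl
inject₁-or-fromℕ {suc n} Fin.zero    = inj₁ (Fin.zero , refl)
inject₁-or-fromℕ {suc n} (Fin.suc v) =
  Sum.map (λ { (i , refl) → Fin.suc i , refl }) (cong Fin.suc) (inject₁-or-fromℕ v)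

module _ {m : ℕ} where

  Consistent : ∀ {n} → Gates m n → (ℕ → Maybe Bool) → (Fin n → Bool) → Set
  Consistent []              ov b = ⊤
  Consistent (_▷_ {n} G g) ov b =
    Consistent G ov (b ∘ inject₁) × b (fromℕ n) ≡ fromMaybe (evalGate g (b ∘ inject₁)) (ov n)

  Consistent-cong : ∀ {n} (G : Gates m n) ov {b b′ : Fin n → Bool} →
                    (∀ v → b v ≡ b′ v) → Consistent G ov b → Consistent G ov b′
  Consistent-cong []            ov b≗b′ _         = tt
  Consistent-cong (_▷_ {n} G g) ov b≗b′ (cG , bₙ) =
    Consistent-cong G ov (b≗b′ ∘ inject₁) cG ,
    trans (sym (b≗b′ (fromℕ n)))
          (trans bₙ (cong (λ u → fromMaybe (Gate.fn g u) (ov n)) (vmap-cong (b≗b′ ∘ inject₁) (Gate.fanin g))))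

  module _ (x : Vec Bool m) where

    lookup-simulate-inject₁ : ∀ {n} (G : Gates m n) g ov i →
      lookup (simulate (G ▷ g) x ov) (inject₁ i) ≡ lookup (simulate G x ov) i
    lookup-simulate-inject₁ {n} G g ov i with simulate G x ov | ov n
    ... | s | just c  = lookup-∷ʳ-inject₁ s c i
    ... | s | nothing = lookup-∷ʳ-inject₁ s _ i

    lookup-simulate-fromℕ : ∀ {n} (G : Gates m n) g ov →
      lookup (simulate (G ▷ g) x ov) (fromℕ n) ≡ fromMaybe (evalGate g (lookup (simulate G x ov))) (ov n)
    lookup-simulate-fromℕ {n} G g ov with simulate G x ov | ov n
    ... | s | just c  = lookup-∷ʳ-fromℕ s c
    ... | s | nothing = lookup-∷ʳ-fromℕ s _

    simulate-consistent : ∀ {n} (G : Gates m n) ov → Consistent G ov (lookup (simulate G x ov))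
    simulate-consistent []      ov = tt
    simulate-consistent (G ▷ g) ov =
      Consistent-cong G ov (sym ∘ lookup-simulate-inject₁ G g ov) (simulate-consistent G ov) ,
      trans (lookup-simulate-fromℕ G g ov)
            (cong (λ u → fromMaybe (Gate.fn g u) (ov _))
                  (vmap-cong (sym ∘ lookup-simulate-inject₁ G g ov) (Gate.fanin g)))

    lookup-simulate-inputVar : ∀ {n} (G : Gates m n) ov i → lookup (simulate G x ov) (inputVar G i) ≡ lookup x i
    lookup-simulate-inputVar []      ov i = refl
    lookup-simulate-inputVar (G ▷ g) ov i =
      trans (lookup-simulate-inject₁ G g ov (inputVar G i)) (lookup-simulate-inputVar G ov i)

    consistent⇒≗simulate : ∀ {n} (G : Gates m n) {ov} {b : Fin n → Bool} → Consistent G ov b →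
                           (∀ i → b (inputVar G i) ≡ lookup x i) → ∀ v → b v ≡ lookup (simulate G x ov) v
    consistent⇒≗simulate []                 _         onInputs v = onInputs v
    consistent⇒≗simulate (_▷_ {n} G g) {ov} {b} (cG , bₙ) onInputs v with inject₁-or-fromℕ v
    ... | inj₁ (i , refl) =
      trans (consistent⇒≗simulate G cG onInputs i) (sym (lookup-simulate-inject₁ G g ov i))
    ... | inj₂ refl =
      trans bₙ (trans (cong (λ u → fromMaybe (Gate.fn g u) (ov n)) (vmap-cong b≗s (Gate.fanin g)))
                      (sym (lookup-simulate-fromℕ G g ov)))
      where
        b≗s : ∀ i → b (inject₁ i) ≡ lookup (simulate G x ov) i
        b≗s = consistent⇒≗simulate G cG onInputs

    simulate-cong-upTo : ∀ {n} (G : Gates m n) {ov ov′} v → (∀ k → k ≤ toℕ v → ov k ≡ ov′ k) →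
                         lookup (simulate G x ov) v ≡ lookup (simulate G x ov′) v
    simulate-cong-upTo []            v ov≡ = refl
    simulate-cong-upTo (_▷_ {n} G g) {ov} {ov′} v ov≡ with inject₁-or-fromℕ v
    ... | inj₁ (i , refl) =
      trans (lookup-simulate-inject₁ G g ov i)
            (trans (simulate-cong-upTo G i (λ k k≤i → ov≡ k (subst (k ≤_) (sym (toℕ-inject₁ i)) k≤i)))
                   (sym (lookup-simulate-inject₁ G g ov′ i)))
    ... | inj₂ refl =
      trans (lookup-simulate-fromℕ G g ov)
            (trans (cong₂ (λ o u → fromMaybe (Gate.fn g u) o) (ov≡ n (≤-reflexive (sym (toℕ-fromℕ n))))
                          (vmap-cong earlier≡ (Gate.fanin g)))
                   (sym (lookup-simulate-fromℕ G g ov′)))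
      where
        earlier≡ : ∀ i → lookup (simulate G x ov) i ≡ lookup (simulate G x ov′) i
        earlier≡ i = simulate-cong-upTo G i λ k k≤i →
          ov≡ k (subst (k ≤_) (sym (toℕ-fromℕ n)) (<⇒≤ (≤-<-trans k≤i (toℕ<n i))))

toℕ-inputVar : ∀ {m n} (G : Gates m n) i → toℕ (inputVar G i) ≡ toℕ i
toℕ-inputVar []      i = refl
toℕ-inputVar (G ▷ g) i = trans (toℕ-inject₁ (inputVar G i)) (toℕ-inputVar G i)

module _ {n} (b : Fin (suc n) → Bool) where

  litVal-liftLit : ∀ l → litVal b (liftLit l) ≡ litVal (b ∘ inject₁) l
  litVal-liftLit (v , true)  = refl
  litVal-liftLit (v , false) = refl

  clauseVal-liftClause : ∀ D → clauseVal b (liftClause D) ≡ clauseVal (b ∘ inject₁) D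
  clauseVal-liftClause D = cong or (trans (sym (map-∘ D)) (map-cong litVal-liftLit D))

  Satisfies-liftClauses⁺ : ∀ {F} → Satisfies (b ∘ inject₁) F → Satisfies b (map liftClause F)
  Satisfies-liftClauses⁺ = map⁺ ∘ All.map (λ {D} → subst T (sym (clauseVal-liftClause D)))

  Satisfies-liftClauses⁻ : ∀ {F} → Satisfies b (map liftClause F) → Satisfies (b ∘ inject₁) F
  Satisfies-liftClauses⁻ = All.map (λ {D} → subst T (clauseVal-liftClause D)) ∘ map⁻

  lastGate-consistent : ∀ (g : Gate n) (ov : ℕ → Maybe Bool) → ov n ≡ nothing →
                        Satisfies b (gateClauses (liftGate g) (fromℕ n)) →
                        b (fromℕ n) ≡ fromMaybe (evalGate g (b ∘ inject₁)) (ov n)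
  lastGate-consistent g ov ovₙ sat rewrite ovₙ =
    trans (Satisfies-gateClauses⁻ _ (Gate.fn g) (fromℕ n) b sat) (evalGate-liftGate g b)

liftLit-injective : ∀ {n} {l l′ : Lit (Fin n)} → liftLit l ≡ liftLit l′ → l ≡ l′
liftLit-injective {l = v , c} {v′ , c′} eq = cong₂ _,_ (inject₁-injective (cong proj₁ eq)) (cong proj₂ eq)

fromℕ∉liftClause : ∀ {n} (D : Clause (Fin n)) {c} → (fromℕ n , c) ∉ liftClause D
fromℕ∉liftClause D fromℕ∈ with ∈-map⁻ liftLit fromℕ∈
... | _ , _ , eq = fromℕ≢inject₁ (cong proj₁ eq)

module _ {m : ℕ} where

  Satisfies-encode⁺ : ∀ {n} (G : Gates m n) {b : Fin n → Bool} → Consistent G noOverride b → Satisfies b (encode G)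
  Satisfies-encode⁺ []            _         = []
  Satisfies-encode⁺ (_▷_ {n} G g) {b} (cG , bₙ) =
    ++⁺ (Satisfies-liftClauses⁺ b (Satisfies-encode⁺ G cG))
        (Satisfies-gateClauses⁺ _ (Gate.fn g) (fromℕ n) b (trans bₙ (sym (evalGate-liftGate g b))))

  Satisfies-encode⁻ : ∀ {n} (G : Gates m n) {ov} {b : Fin n → Bool} → (∀ k → k < n → ov k ≡ nothing) →
                      Satisfies b (encode G) → Consistent G ov b
  Satisfies-encode⁻ []            _        _   = tt
  Satisfies-encode⁻ (_▷_ {n} G g) {ov} {b} unforced sat =
    Satisfies-encode⁻ G (λ k k<n → unforced k (m<n⇒m<1+n k<n)) (Satisfies-liftClauses⁻ b (++⁻ˡ _ sat)) ,
    lastGate-consistent b g ov (unforced n (n<1+n n)) (++⁻ʳ (map liftClause (encode G)) sat)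

-- Forcing the AND gate to 0

andClause : ∀ {n} → Fin n → Fin n → Fin n → Clause (Fin n)
andClause v₁ v₂ v₃ = (v₁ , false) ∷ (v₂ , false) ∷ (v₃ , true) ∷ []

andClause-satisfied : ∀ {n} (b : Fin n → Bool) {v₁ v₂ v₃} → b v₃ ≡ b v₁ ∧ b v₂ →
                      T (clauseVal b (andClause v₁ v₂ v₃))
andClause-satisfied b {v₁} {v₂} b₃ rewrite b₃ with b v₁ | b v₂
... | true  | true  = _
... | true  | false = _
... | false | _     = _

ForcesZeroAt : ℕ → (ℕ → Maybe Bool) → Set
ForcesZeroAt k ov = ov k ≡ just false × (∀ i → i ≢ k → ov i ≡ nothing)

forceZero-forcesZeroAt : ∀ {n} (w : Fin n) → ForcesZeroAt (toℕ w) (forceZero w)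
forceZero-forcesZeroAt w = forced , unforced
  where
    forced : forceZero w (toℕ w) ≡ just false
    forced rewrite to T-≡ (≡⇒≡ᵇ (toℕ w) (toℕ w) refl) = refl

    unforced : ∀ i → i ≢ toℕ w → forceZero w i ≡ nothing
    unforced i i≢w rewrite ¬T⇒≡false (i≢w ∘ ≡ᵇ⇒≡ i (toℕ w)) = refl

module _ {m : ℕ} where

  andGate-forced-consistent :
    ∀ {n} {G : Gates m n} {v₁ v₂ v₃} {ov} {b : Fin n → Bool} → AndGate G v₁ v₂ v₃ → ForcesZeroAt (toℕ v₃) ov →
    SatisfiesAllBut b (andClause v₁ v₂ v₃) (encode G) → b v₃ ≡ false → Consistent G ov b
  andGate-forced-consistent {ov = ov} {b} (here {n} {G} {v₁} {v₂} _) (forced , unforced) sat b₃ =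
    Satisfies-encode⁻ G (λ k k<n → unforced k (λ k≡ → <-irrefl (trans k≡ (toℕ-fromℕ n)) k<n))
      (All.tabulate λ {D} D∈ →
        subst T (clauseVal-liftClause b D) (sat (∈-++⁺ˡ (∈-map⁺ liftClause D∈)) (avoid D))) ,
    trans b₃ (cong (fromMaybe _) (sym (subst (λ k → ov k ≡ just false) (toℕ-fromℕ n) forced)))
    where
      avoid : ∀ D → liftClause D ≢ andClause (inject₁ v₁) (inject₁ v₂) (fromℕ n)
      avoid D eq = fromℕ∉liftClause D {true} (subst (_ ∈_) (sym eq) (there (there (here refl))))
  andGate-forced-consistent {ov = ov} {b} (there {n} {G} {g} {v₁} {v₂} {v₃} and-g) (forced , unforced) sat b₃ =
    andGate-forced-consistent and-g
      (subst (λ k → ov k ≡ just false) (toℕ-inject₁ v₃) forced ,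
       λ k k≢v₃ → unforced k (λ k≡ → k≢v₃ (trans k≡ (toℕ-inject₁ v₃))))
      (λ {D} D∈ D≢ → subst T (clauseVal-liftClause b D)
                       (sat (∈-++⁺ˡ (∈-map⁺ liftClause D∈)) (D≢ ∘ map-injective liftLit-injective)))
      b₃ ,
    lastGate-consistent b g ov (unforced n (λ n≡ → <-irrefl (sym (trans n≡ (toℕ-inject₁ v₃))) (toℕ<n v₃)))
      (All.tabulate λ D∈ → sat (∈-++⁺ʳ _ D∈) (avoid D∈))
    where
      avoid : ∀ {D} → D ∈ gateClauses (liftGate g) (fromℕ n) → D ≢ liftClause (andClause v₁ v₂ v₃)
      avoid D∈ eq with ∈-gateClauses-output (Vec.map inject₁ (Gate.fanin g)) (Gate.fn g) (fromℕ n) D∈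
      ... | _ , fromℕ∈ = fromℕ∉liftClause (andClause v₁ v₂ v₃) (subst (_ ∈_) eq fromℕ∈)

andGate-fanin< : ∀ {m n} {G : Gates m n} {v₁ v₂ v₃} → AndGate G v₁ v₂ v₃ → toℕ v₁ < toℕ v₃ × toℕ v₂ < toℕ v₃
andGate-fanin< (here {n} {v₁ = v₁} {v₂} _)
  rewrite toℕ-inject₁ v₁ | toℕ-inject₁ v₂ | toℕ-fromℕ n = toℕ<n v₁ , toℕ<n v₂
andGate-fanin< (there {v₁ = v₁} {v₂} {v₃} and-g)
  rewrite toℕ-inject₁ v₁ | toℕ-inject₁ v₂ | toℕ-inject₁ v₃ = andGate-fanin< and-g

simulate-andGate : ∀ {m n} (x : Vec Bool m) {G : Gates m n} {v₁ v₂ v₃} → AndGate G v₁ v₂ v₃ →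
                   lookup (simulate G x noOverride) v₃
                     ≡ lookup (simulate G x noOverride) v₁ ∧ lookup (simulate G x noOverride) v₂
simulate-andGate x (here {G = G} {v₁} {v₂} {f} f≡∧) =
  trans (lookup-simulate-fromℕ x G g noOverride)
        (trans (f≡∧ _ _) (sym (cong₂ _∧_ (lookup-simulate-inject₁ x G g noOverride v₁)
                                         (lookup-simulate-inject₁ x G g noOverride v₂))))
  where
    g : Gate _
    g = mkGate 2 (v₁ ∷ v₂ ∷ []) f
simulate-andGate x (there {G = G} {g} {v₁} {v₂} {v₃} and-g) =
  trans (lookup-simulate-inject₁ x G g noOverride v₃)
        (trans (simulate-andGate x and-g) (sym (cong₂ _∧_ (lookup-simulate-inject₁ x G g noOverride v₁)
                                                          (lookup-simulate-inject₁ x G g noOverride v₂))))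

inputVar-fromℕ< : ∀ {m n} (G : Gates m n) {v : Fin n} (v<m : toℕ v < m) → inputVar G (fromℕ< v<m) ≡ v
inputVar-fromℕ< G v<m = toℕ-injective (trans (toℕ-inputVar G (fromℕ< v<m)) (toℕ-fromℕ< v<m))

module _ {m p : ℕ} where

  blockingClause : Vec Bool m → Clause (Fin m ⊎ Fin p)
  blockingClause x′ = map (λ i → inj₁ i , not (lookup x′ i)) (allFin m)

  testClause : Vec Bool m → Vec Bool p → Fin p → Clause (Fin m ⊎ Fin p)
  testClause x′ z′ j = blockingClause x′ ++ ((inj₂ j , lookup z′ j) ∷ [])

  testClauses : Vec Bool m → Vec Bool p → Vec Bool p → CNF (Fin m ⊎ Fin p)
  testClauses x′ z′ z* =
    map (testClause x′ z′) (filterᵇ (λ j → not (does (lookup z′ j ≟ᵇ lookup z* j))) (allFin p))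

  private
    val : Vec Bool m → Vec Bool p → Fin m ⊎ Fin p → Bool
    val x z = [ lookup x , lookup z ]

  T-blockingClause : ∀ {x x′} z → x ≢ x′ → T (clauseVal (val x z) (blockingClause x′))
  T-blockingClause {x} {x′} z x≢x′
    with ¬∀⟶∃¬ m (λ i → lookup x i ≡ lookup x′ i) (λ i → lookup x i ≟ᵇ lookup x′ i) (x≢x′ ∘ Pointwise-≡⇒≡ ∘ ext)
  ... | i , xᵢ≢x′ᵢ = T-clauseVal⁺ (val x z) (∈-map⁺ _ (∈-allFin i)) (T-litVal-not (val x z) xᵢ≢x′ᵢ)

  ¬T-blockingClause : ∀ x′ z → ¬ T (clauseVal (val x′ z) (blockingClause x′))
  ¬T-blockingClause x′ z = ¬T-clauseVal⁺ (val x′ z) falsified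
    where
      falsified : ∀ {l} → l ∈ blockingClause x′ → ¬ T (litVal (val x′ z) l)
      falsified l∈ with ∈-map⁻ _ l∈
      ... | i , _ , refl = ¬T-litVal-not (val x′ z) {inj₁ i} refl

  testClauses-offTest : ∀ {x x′} z z′ z* → x ≢ x′ → Satisfies (val x z) (testClauses x′ z′ z*)
  testClauses-offTest {x′ = x′} z z′ z* x≢x′ =
    map⁺ (All.universal (λ _ → T-clauseVal-++ˡ _ (blockingClause x′) (T-blockingClause z x≢x′)) _)

  testClauses-expected : ∀ x′ z′ z* → Satisfies (val x′ z′) (testClauses x′ z′ z*)
  testClauses-expected x′ z′ z* = map⁺ (All.universal expected _)
    where
      expected : ∀ j → T (clauseVal (val x′ z′) (testClause x′ z′ j))
      expected j = T-clauseVal⁺ (val x′ z′) (∈-++⁺ʳ (blockingClause x′) (here refl))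
                                (from (T-litVal (val x′ z′) (inj₂ j) (lookup z′ j)) refl)

  testClauses-detects : ∀ x′ {z′ z*} → z* ≢ z′ → ¬ Satisfies (val x′ z*) (testClauses x′ z′ z*)
  testClauses-detects x′ {z′} {z*} z*≢z′ sat
    with ¬∀⟶∃¬ p (λ j → lookup z′ j ≡ lookup z* j) (λ j → lookup z′ j ≟ᵇ lookup z* j)
               (z*≢z′ ∘ sym ∘ Pointwise-≡⇒≡ ∘ ext)
  ... | j , z′ⱼ≢z*ⱼ =
    falsified (All.lookup sat (∈-map⁺ (testClause x′ z′)
                (∈-filter⁺ (T? ∘ _) (∈-allFin j) (T-not-does⁺ (lookup z′ j ≟ᵇ lookup z* j) z′ⱼ≢z*ⱼ))))
    where
      falsified : ¬ T (clauseVal (val x′ z*) (testClause x′ z′ j))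
      falsified t with T-clauseVal-++⁻ (val x′ z*) (blockingClause x′) t
      ... | inj₁ tB = ¬T-blockingClause x′ z* tB
      ... | inj₂ tz = [ z′ⱼ≢z*ⱼ ∘ sym ∘ to (T-litVal (val x′ z*) (inj₂ j) (lookup z′ j)) , (λ ()) ] (to T-∨ tz)

  testClauses-singleTestProperty : ∀ (N : Circuit m p) x′ z* → z* ≢ outputs N x′ noOverride →
                                   SingleTestProperty N x′ (testClauses x′ (outputs N x′ noOverride) z*)
  testClauses-singleTestProperty N x′ z* z*≢z′ =
    (λ x z x≢x′ → to (Satisfies⇔cnfVal _ _) (testClauses-offTest z z′ z* x≢x′)) ,
    to (Satisfies⇔cnfVal _ _) (testClauses-expected x′ z′ z*) ,
    z* , z*≢z′ , ¬T⇒≡false (testClauses-detects x′ z*≢z′ ∘ all⁺ _ _)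
    where
      z′ : Vec Bool p
      z′ = outputs N x′ noOverride

-- Correctness of QuickPQE

module _ {m p} (N : Circuit m p) where

  AgreeOnXZ : (Fin (nvars N) → Bool) → (Fin (nvars N) → Bool) → Set
  AgreeOnXZ a b = ∀ v → IsInput N v ⊎ IsOutput N v → a v ≡ b v

  equivExistsY-if-repairable :
    ∀ D F → (∀ b → Satisfies b F → ¬ T (clauseVal b D) → ∃ λ b′ → AgreeOnXZ b′ b × Satisfies b′ (D ∷ F)) →
    EquivExistsY N (D ∷ F) F
  equivExistsY-if-repairable D F repair a = drop , add
    where
      drop : ExistsY N (D ∷ F) a → ExistsY N F a
      drop (b , agree , sat) =
        b , agree , to (Satisfies⇔cnfVal b F) (All.tail (from (Satisfies⇔cnfVal b (D ∷ F)) sat))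

      add′ : ∀ b → AgreeOnXZ b a → Satisfies b F → ExistsY N (D ∷ F) a
      add′ b agree satF with T? (clauseVal b D)
      ... | yes t = b , agree , to (Satisfies⇔cnfVal b (D ∷ F)) (t ∷ satF)
      ... | no ¬t with repair b satF ¬t
      ...   | b′ , agree′ , sat′ =
        b′ , (λ v xz → trans (agree′ v xz) (agree v xz)) , to (Satisfies⇔cnfVal b′ (D ∷ F)) sat′

      add : ExistsY N F a → ExistsY N (D ∷ F) a
      add (b , agree , sat) = add′ b agree (from (Satisfies⇔cnfVal b F) sat)

module QuickPQE-correct {m p} (N : Circuit m p) (pol : Vec Bool m) (v₁ v₂ v₃ : Fin (nvars N))
                        (and-g : AndGate (gates N) v₁ v₂ v₃) where

  private
    run forcedRun : Fin (nvars N) → Bool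
    run       = lookup (simulate (gates N) pol noOverride)
    forcedRun = lookup (simulate (gates N) pol (forceZero v₃))

    z′ z* : Vec Bool p
    z′ = outputs N pol noOverride
    z* = outputs N pol (forceZero v₃)

    C′ₓ : Clause (Fin (nvars N))
    C′ₓ = C′ N pol v₁ v₂ v₃

    F′ₓ : CNF (Fin (nvars N))
    F′ₓ = F′ N pol v₁ v₂ v₃

  clauseEqᵇ-sound : ∀ D E → T (clauseEqᵇ N pol v₁ v₂ v₃ D E) → D ≡ E
  clauseEqᵇ-sound []                []                _ = refl
  clauseEqᵇ-sound ((v , c) ∷ D) ((w , d) ∷ E) t
    with to (T-∧ {does (v ≟ᶠ w) ∧ does (c ≟ᵇ d)}) t
  ... | tl , tD with to (T-∧ {does (v ≟ᶠ w)}) tl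
  ...   | tv , tc = cong₂ _∷_ (cong₂ _,_ (T-does⁻ (v ≟ᶠ w) tv) (T-does⁻ (c ≟ᵇ d) tc)) (clauseEqᵇ-sound D E tD)

  forcing-preserves-fanin : forcedRun v₁ ≡ run v₁ × forcedRun v₂ ≡ run v₂
  forcing-preserves-fanin = preserved (proj₁ (andGate-fanin< and-g)) , preserved (proj₂ (andGate-fanin< and-g))
    where
      preserved : ∀ {v} → toℕ v < toℕ v₃ → forcedRun v ≡ run v
      preserved {v} v<v₃ = simulate-cong-upTo pol (gates N) v λ k k≤v →
        proj₂ (forceZero-forcesZeroAt v₃) k (λ k≡v₃ → <-irrefl k≡v₃ (≤-<-trans k≤v v<v₃))

  run-satisfies : Satisfies run (C′ₓ ∷ F′ₓ)
  run-satisfies =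
    C∨-satisfied (map (negLit ∘ lx N pol v₁ v₂ v₃) (allFin m)) ∷
    ++⁺ (filter⁺ (T? ∘ _) (Satisfies-encode⁺ (gates N) (simulate-consistent pol (gates N) noOverride)))
        (map⁺ (All.universal (λ i → C∨-satisfied (lx N pol v₁ v₂ v₃ i ∷ [])) (allFin m)))
    where
      C∨-satisfied : ∀ E → T (clauseVal run (andClause v₁ v₂ v₃ ++ E))
      C∨-satisfied E =
        T-clauseVal-++ˡ run (andClause v₁ v₂ v₃) {E} (andClause-satisfied run (simulate-andGate pol and-g))

  module Falsifier {b} (sat : Satisfies b F′ₓ) (fals : ¬ T (clauseVal b C′ₓ)) where

    falsified : ∀ {v c} → (v , c) ∈ C′ₓ → b v ≡ not c
    falsified = ¬T-litVal b ∘ ¬T-clauseVal⁻ b {D = C′ₓ} fals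

    b-v₁ : b v₁ ≡ true
    b-v₁ = falsified (here refl)

    b-v₂ : b v₂ ≡ true
    b-v₂ = falsified (there (here refl))

    b-v₃ : b v₃ ≡ false
    b-v₃ = falsified (there (there (here refl)))

    b-inputs : ∀ i → b (inputVar (gates N) i) ≡ lookup pol i
    b-inputs i =
      trans (falsified (∈-++⁺ʳ (andClause v₁ v₂ v₃) (∈-map⁺ (negLit ∘ lx N pol v₁ v₂ v₃) (∈-allFin i))))
            (not-involutive _)

    b-allButC : SatisfiesAllBut b (andClause v₁ v₂ v₃) (F N)
    b-allButC {D} D∈ D≢C =
      All.lookup sat (∈-++⁺ˡ (∈-filter⁺ (T? ∘ _) D∈ (from T-not-≡ (¬T⇒≡false (D≢C ∘ clauseEqᵇ-sound D _)))))

    b≗forcedRun : ∀ v → b v ≡ forcedRun v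
    b≗forcedRun = consistent⇒≗simulate pol (gates N)
                    (andGate-forced-consistent and-g (forceZero-forcesZeroAt v₃) b-allButC b-v₃) b-inputs

    run-fanin-true : run v₁ ∧ run v₂ ≡ true
    run-fanin-true = cong₂ _∧_ (fanin-true v₁ b-v₁ (proj₁ forcing-preserves-fanin))
                               (fanin-true v₂ b-v₂ (proj₂ forcing-preserves-fanin))
      where
        fanin-true : ∀ v → b v ≡ true → forcedRun v ≡ run v → run v ≡ true
        fanin-true v bv forced≡ = trans (sym forced≡) (trans (sym (b≗forcedRun v)) bv)

  nonRedundant⇒fanin-true : NonRedundant N pol v₁ v₂ v₃ → run v₁ ∧ run v₂ ≡ true
  nonRedundant⇒fanin-true nonRedundant = ¬-not λ fanin-false →
    nonRedundant (equivExistsY-if-repairable N C′ₓ F′ₓ λ b sat fals →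
      contradiction (trans (sym (Falsifier.run-fanin-true {b} sat fals)) fanin-false) λ ())

  nonRedundant⇒outputs-differ : NonRedundant N pol v₁ v₂ v₃ → z* ≢ z′
  nonRedundant⇒outputs-differ nonRedundant z*≡z′ =
    nonRedundant (equivExistsY-if-repairable N C′ₓ F′ₓ repair)
    where
      repair : ∀ b → Satisfies b F′ₓ → ¬ T (clauseVal b C′ₓ) →
               ∃ λ b′ → AgreeOnXZ N b′ b × Satisfies b′ (C′ₓ ∷ F′ₓ)
      repair b sat fals = run , agree , run-satisfies
        where
          open Falsifier sat fals
          open ≡-Reasoning

          agree : AgreeOnXZ N run b
          agree v (inj₁ v<m) = subst (λ u → run u ≡ b u) (inputVar-fromℕ< (gates N) v<m)
            (trans (lookup-simulate-inputVar pol (gates N) noOverride i) (sym (b-inputs i)))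
            where
              i : Fin m
              i = fromℕ< v<m
          agree _ (inj₂ (j , refl)) = begin
            run (out N j)       ≡⟨ lookup∘tabulate _ j ⟨
            lookup z′ j         ≡⟨ cong (λ z → lookup z j) z*≡z′ ⟨
            lookup z* j         ≡⟨ lookup∘tabulate _ j ⟩
            forcedRun (out N j) ≡⟨ b≗forcedRun (out N j) ⟨
            b (out N j)         ∎

  QuickPQE-reaches-step3 : run v₁ ∧ run v₂ ≡ true → z* ≢ z′ → QuickPQE N pol v₁ v₂ v₃ ≡ testClauses pol z′ z*
  QuickPQE-reaches-step3 fanin-true z*≢z′ rewrite fanin-true | dec-false (vec-≡-dec _≟ᵇ_ z* z′) z*≢z′ = refl

proposition2 : ∀ {m p} (N : Circuit m p) (pol : Vec Bool m) (v₁ v₂ v₃ : Fin (nvars N)) →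
                 AndGate (gates N) v₁ v₂ v₃ →
                 m ≤ toℕ v₁ → m ≤ toℕ v₂ → m ≤ toℕ v₃ →
                 NonRedundant N pol v₁ v₂ v₃ →
                 SingleTestProperty N pol (QuickPQE N pol v₁ v₂ v₃)
proposition2 N pol v₁ v₂ v₃ and-g _ _ _ nonRedundant =
  subst (SingleTestProperty N pol)
        (sym (QuickPQE-reaches-step3 (nonRedundant⇒fanin-true nonRedundant) outputs-differ))
        (testClauses-singleTestProperty N pol _ outputs-differ)
  where
    open QuickPQE-correct N pol v₁ v₂ v₃ and-g

    outputs-differ : outputs N pol (forceZero v₃) ≢ outputs N pol noOverride
    outputs-differ = nonRedundant⇒outputs-differ nonRedundant
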